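{- Let $G$ be a graph with $n$ vertices, and let $H$ be an induced proper subgraph of $G$ such that $H$ is connected, $2\leq|V(H)|\leq n-1$, and every vertex $u\in V(G)\setminus V(H)$ that is adjacent to some vertex of $V(H)$ is adjacent to every vertex of $V(H)$. Then $S_e\subseteq E(H)$ for every edge $e\in E(H)$.
   Context: For $e\in E(G)$, let $\mathcal{S}_e$ be the family of all sets $S\subseteq E(G)$ such that $e\in S$ and, for every edge $d\notin S$, there is no induced copy of $P_3$ in $G$ consisting of $d$ and an edge of $S$. $S_e$ denotes the member of $\mathcal{S}_e$ of minimum cardinality (it is unique; equivalently it is the intersection of all members of $\mathcal{S}_e$). -}

module Defs where

open import Data.Nat using (ℕ; zero; suc; _+_; _≤_)
open import Data.Bool using (Bool; true; false; if_then_else_)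
open import Data.Fin using (Fin; _<_)
open import Data.Fin.Subset using (Subset; _∈_; _∉_)
open import Data.Product using (_×_; Σ; ∃-syntax)
open import Data.Sum using (_⊎_)
open import Relation.Nullary using (¬_)
open import Relation.Binary.PropositionalEquality using (_≡_; _≢_)

record Graph (n : ℕ) : Set where
  field
    adj   : Fin n → Fin n → Bool
    sym   : ∀ i j → adj i j ≡ adj j i
    irref : ∀ i → adj i i ≡ false
open Graph public

Adj : ∀ {n} → Graph n → Fin n → Fin n → Set
Adj G i j = adj G i j ≡ true

-- A set of edges of G.  An edge {i,j} is stored in canonical orientation
-- i < j, so S i j ≡ true means the edge {i,j} (with i < j) belongs to S.
EdgeSet : ℕ → Set
EdgeSet n = Fin n → Fin n → Bool

WellFormed : ∀ {n} → Graph n → EdgeSet n → Set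
WellFormed G S = ∀ i j → S i j ≡ true → (i < j) × Adj G i j

InSet : ∀ {n} → EdgeSet n → Fin n → Fin n → Set
InSet S i j = (S i j ≡ true) ⊎ (S j i ≡ true)

count : ∀ {n} → (Fin n → Bool) → ℕ
count {zero}  f = 0
count {suc n} f = (if f Fin.zero then 1 else 0) + count (λ i → f (Fin.suc i))

card : ∀ {n} → EdgeSet n → ℕ
card {zero}  S = 0
card {suc n} S = count (S Fin.zero) + card (λ i j → S (Fin.suc i) (Fin.suc j))
               + count (λ j → S (Fin.suc j) Fin.zero)

InducedP3 : ∀ {n} → Graph n → Fin n → Fin n → Fin n → Set
InducedP3 G a b c = Adj G a b × Adj G b c × a ≢ c × ¬ Adj G a c

-- Membership in the family 𝒮_e, for e = {u,v}:
-- S ⊆ E(G), e ∈ S, and for every edge d ∉ S there is no induced P3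
-- consisting of d and an edge of S.  (An induced P3 consisting of edges d
-- and f has d = {a,b}, f = {b,c} with a - b - c induced.)
InFamily : ∀ {n} → Graph n → Fin n → Fin n → EdgeSet n → Set
InFamily G u v S =
  WellFormed G S × InSet S u v ×
  (∀ a b c → ¬ InSet S a b → ¬ (InducedP3 G a b c × InSet S b c))

IsSe : ∀ {n} → Graph n → Fin n → Fin n → EdgeSet n → Set
IsSe G u v S = InFamily G u v S × (∀ T → InFamily G u v T → card S ≤ card T)

data WalkIn {n} (G : Graph n) (W : Subset n) : Fin n → Fin n → Set where
  here  : ∀ {x} → x ∈ W → WalkIn G W x x
  step  : ∀ {x y z} → x ∈ W → Adj G x y → WalkIn G W y z → WalkIn G W x z

ConnectedIn : ∀ {n} → Graph n → Subset n → Set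
ConnectedIn G W = ∀ x y → x ∈ W → y ∈ W → WalkIn G W x y

Module : ∀ {n} → Graph n → Subset n → Set
Module G W = ∀ u → u ∉ W → (∃[ w ] (w ∈ W × Adj G u w)) → ∀ w → w ∈ W → Adj G u w

-- Restricting a member S of 𝒮_e to the vertex set of H gives again a member
-- of 𝒮_e: an induced P3 x - y - z with {y,z} inside H cannot start outside H,
-- since a vertex outside H adjacent to y is adjacent to z as well.  So S_e,
-- being of minimum cardinality, loses no edge under this restriction, i.e.
-- it lies inside H.
module Submission where

open import Defs
open import Data.Nat using (ℕ; _≤_; _<_; _∸_; zero; suc; z≤n; s≤s)
open import Data.Nat.Properties using (≤-refl; +-mono-≤; +-mono-<-≤; +-mono-≤-<; <⇒≱)
open import Data.Bool using (Bool; true; false; _∧_; if_then_else_)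
open import Data.Bool.Properties using (∧-conicalˡ; ∧-conicalʳ)
open import Data.Fin using (Fin)
open import Data.Fin.Subset using (Subset; _∈_; ∣_∣)
open import Data.Fin.Subset.Properties using (_∈?_)
open import Data.Vec using (lookup)
open import Data.Vec.Properties using ([]=⇒lookup; lookup⇒[]=)
open import Data.Product using (_×_; _,_)
open import Data.Sum using (inj₁; inj₂)
open import Data.Empty using (⊥-elim)
open import Function using (_∘_)
open import Relation.Nullary using (¬_; yes; no)
open import Relation.Binary.PropositionalEquality using (_≡_; refl; cong₂)

private
  variable
    n : ℕ

bit : Bool → ℕ
bit b = if b then 1 else 0

bit-mono : ∀ {a b} → (a ≡ true → b ≡ true) → bit a ≤ bit b
bit-mono {false} _ = z≤n
bit-mono {true}  h rewrite h refl = ≤-refl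

bit-< : ∀ {a b} → a ≡ false → b ≡ true → bit a < bit b
bit-< refl refl = s≤s z≤n

_⊆ᵇ_ : (Fin n → Bool) → (Fin n → Bool) → Set
f ⊆ᵇ g = ∀ i → f i ≡ true → g i ≡ true

count-mono : {f g : Fin n → Bool} → f ⊆ᵇ g → count f ≤ count g
count-mono {zero}  h = z≤n
count-mono {suc n} h = +-mono-≤ (bit-mono (h Fin.zero)) (count-mono (h ∘ Fin.suc))

count-< : {f g : Fin n → Bool} → f ⊆ᵇ g → ∀ k → f k ≡ false → g k ≡ true →
          count f < count g
count-< h Fin.zero    fk gk = +-mono-<-≤ (bit-< fk gk) (count-mono (h ∘ Fin.suc))
count-< h (Fin.suc k) fk gk =
  +-mono-≤-< (bit-mono (h Fin.zero)) (count-< (h ∘ Fin.suc) k fk gk)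

_⊆ᴱ_ : EdgeSet n → EdgeSet n → Set
T ⊆ᴱ S = ∀ i j → T i j ≡ true → S i j ≡ true

card-mono : {T S : EdgeSet n} → T ⊆ᴱ S → card T ≤ card S
card-mono {zero}  h = z≤n
card-mono {suc n} h =
  +-mono-≤ (+-mono-≤ (count-mono (h Fin.zero))
                     (card-mono (λ i j → h (Fin.suc i) (Fin.suc j))))
           (count-mono (λ j → h (Fin.suc j) Fin.zero))

card-< : {T S : EdgeSet n} → T ⊆ᴱ S → ∀ i j → T i j ≡ false → S i j ≡ true →
         card T < card S
card-< h Fin.zero j t s =
  +-mono-<-≤ (+-mono-<-≤ (count-< (h Fin.zero) j t s)
                         (card-mono (λ i j → h (Fin.suc i) (Fin.suc j))))
             (count-mono (λ j → h (Fin.suc j) Fin.zero))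
card-< h (Fin.suc i) Fin.zero t s =
  +-mono-≤-< (+-mono-≤ (count-mono (h Fin.zero))
                       (card-mono (λ i j → h (Fin.suc i) (Fin.suc j))))
             (count-< (λ j → h (Fin.suc j) Fin.zero) i t s)
card-< h (Fin.suc i) (Fin.suc j) t s =
  +-mono-<-≤ (+-mono-≤-< (count-mono (h Fin.zero))
                         (card-< (λ i j → h (Fin.suc i) (Fin.suc j)) i j t s))
             (count-mono (λ j → h (Fin.suc j) Fin.zero))

card-≤⇒⊇ : {T S : EdgeSet n} → T ⊆ᴱ S → card S ≤ card T → S ⊆ᴱ T
card-≤⇒⊇ {T = T} T⊆S S≤T i j s with T i j in t
... | true  = refl
... | false = ⊥-elim (<⇒≱ (card-< T⊆S i j t s) S≤T)

InSet-map : {T S : EdgeSet n} → T ⊆ᴱ S → ∀ {a b} → InSet T a b → InSet S a b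
InSet-map h {a} {b} (inj₁ e) = inj₁ (h a b e)
InSet-map h {a} {b} (inj₂ e) = inj₂ (h b a e)

restrict : Subset n → EdgeSet n → EdgeSet n
restrict W S i j = S i j ∧ (lookup W i ∧ lookup W j)

restrict-⊆ : (W : Subset n) (S : EdgeSet n) → restrict W S ⊆ᴱ S
restrict-⊆ W S i j = ∧-conicalˡ (S i j) _

restrict⁻ : (W : Subset n) (S : EdgeSet n) → ∀ i j →
            restrict W S i j ≡ true → i ∈ W × j ∈ W
restrict⁻ W S i j e =
  lookup⇒[]= i W (∧-conicalˡ _ _ Wij) , lookup⇒[]= j W (∧-conicalʳ (lookup W i) _ Wij)
  where Wij = ∧-conicalʳ (S i j) _ e

InSet-restrict⁻ : (W : Subset n) (S : EdgeSet n) → ∀ {a b} →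
                  InSet (restrict W S) a b → a ∈ W × b ∈ W
InSet-restrict⁻ W S {a} {b} (inj₁ e) = restrict⁻ W S a b e
InSet-restrict⁻ W S {a} {b} (inj₂ e) with restrict⁻ W S b a e
... | bW , aW = aW , bW

InSet-restrict⁺ : (W : Subset n) (S : EdgeSet n) → ∀ {a b} →
                  InSet S a b → a ∈ W → b ∈ W → InSet (restrict W S) a b
InSet-restrict⁺ W S (inj₁ e) aW bW = inj₁ (cong₂ _∧_ e (cong₂ _∧_ ([]=⇒lookup aW) ([]=⇒lookup bW)))
InSet-restrict⁺ W S (inj₂ e) aW bW = inj₂ (cong₂ _∧_ e (cong₂ _∧_ ([]=⇒lookup bW) ([]=⇒lookup aW)))

restrict-InFamily : ∀ (G : Graph n) {W u v S} → Module G W → u ∈ W → v ∈ W →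
                    InFamily G u v S → InFamily G u v (restrict W S)
restrict-InFamily G {W} {u} {v} {S} mod uW vW (wf , Suv , closed) =
  (λ i j → wf i j ∘ restrict-⊆ W S i j) , InSet-restrict⁺ W S Suv uW vW , closedᵂ
  where
  closedᵂ : ∀ x y z → ¬ InSet (restrict W S) x y →
            ¬ (InducedP3 G x y z × InSet (restrict W S) y z)
  closedᵂ x y z ¬xy (p3@(x~y , _ , _ , x≁z) , yz) with InSet-restrict⁻ W S yz | x ∈? W
  ... | yW , _  | yes xW =
    closed x y z (λ Sxy → ¬xy (InSet-restrict⁺ W S Sxy xW yW))
                 (p3 , InSet-map (restrict-⊆ W S) yz)
  ... | yW , zW | no x∉W = x≁z (mod x x∉W (y , yW , x~y) z zW)

IsSe-⊆-module : ∀ (G : Graph n) {W u v S} → Module G W → u ∈ W → v ∈ W →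
                IsSe G u v S → ∀ {a b} → InSet S a b → a ∈ W × b ∈ W
IsSe-⊆-module G {W} {S = S} mod uW vW (member , minimal) ab =
  InSet-restrict⁻ W S (InSet-map S⊆T ab)
  where
  S⊆T : S ⊆ᴱ restrict W S
  S⊆T = card-≤⇒⊇ (restrict-⊆ W S) (minimal _ (restrict-InFamily G mod uW vW member))

lemma11 : ∀ (n : ℕ) (G : Graph n) (VH : Subset n) →
          ConnectedIn G VH → 2 ≤ ∣ VH ∣ → ∣ VH ∣ ≤ n ∸ 1 → Module G VH →
          ∀ (u v : Fin n) → u ∈ VH → v ∈ VH → Adj G u v →
          ∀ (S : EdgeSet n) → IsSe G u v S →
          ∀ (a b : Fin n) → InSet S a b → a ∈ VH × b ∈ VH
lemma11 n G VH _ _ _ mod u v uH vH _ S Se a b = IsSe-⊆-module G mod uH vH Se
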